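{- Let $\mathcal{R}$ be a TRS. Let $a$ be the maximum arity of a function symbol and $b$ the number of rules of $\mathcal{R}$. Let $c$ be a natural number larger than the number of occurrences of any variable in any right-hand side of $\mathcal{R}$ and larger than the size of any right-hand side of $\mathcal{R}$. Set $E:=\max\{2,a,b,c\}+3$, and let $g\colon\mathbb{N}\times\mathbb{N}\to\mathbb{N}$ be given by - $g(0,n)=E$; - $g(m,0)=E\cdot g(m-1,0)$ for $m>0$; - $g(m,n)=E\cdot g(m-1,n)+E\cdot m\cdot g(E\cdot m,n-1)$ for $m,n>0$. Then there exists $d\in\mathbb{N}$ such that for all $m,n\in\mathbb{N}$, $$g(m,n)\leqslant 2^{2^{d\cdot(m+n+1)}}.$$
   Context: The size of a term is the number of occurrences of function symbols and variables in it. -}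

module Defs where

open import Data.Nat using (ℕ; zero; suc; _+_; _*_; _<_; _⊔_)
open import Data.Nat.Properties using (_≟_)
open import Data.Fin using (Fin; zero; suc)
open import Data.List using (List; length)
open import Data.List.Membership.Propositional using (_∈_)
open import Data.Product using (_×_; _,_; proj₁; proj₂; ∃)
open import Relation.Nullary using (¬_; yes; no)
open import Relation.Binary.PropositionalEquality using (_≡_)

record Signature : Set where
  field
    k     : ℕ
    arity : Fin k → ℕ
open Signature public

sumFin : (n : ℕ) → (Fin n → ℕ) → ℕ
sumFin zero    f = 0
sumFin (suc n) f = f zero + sumFin n (λ i → f (suc i))

maxFin : (n : ℕ) → (Fin n → ℕ) → ℕ
maxFin zero    f = 0
maxFin (suc n) f = f zero ⊔ maxFin n (λ i → f (suc i))

data Term (Σ : Signature) : Set where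
  var : ℕ → Term Σ
  fun : (f : Fin (k Σ)) → (Fin (arity Σ f) → Term Σ) → Term Σ

module _ {Σ : Signature} where
  size : Term Σ → ℕ
  size (var x)    = 1
  size (fun f ts) = suc (sumFin (arity Σ f) (λ i → size (ts i)))

  occ : ℕ → Term Σ → ℕ
  occ x (var y) with x ≟ y
  ... | yes _ = 1
  ... | no  _ = 0
  occ x (fun f ts) = sumFin (arity Σ f) (λ i → occ x (ts i))

  IsVar : Term Σ → Set
  IsVar t = ∃ λ x → t ≡ var x

record Rule (Σ : Signature) : Set where
  field
    lhs : Term Σ
    rhs : Term Σ
    lhs-not-var : ¬ IsVar lhs
    vars-rhs⊆lhs : ∀ x → 0 < occ x rhs → 0 < occ x lhs
open Rule public

record TRS : Set where
  field
    sig   : Signature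
    rules : List (Rule sig)
open TRS public

maxArity : TRS → ℕ
maxArity R = maxFin (k (sig R)) (arity (sig R))

numRules : TRS → ℕ
numRules R = length (rules R)

RhsBound : (R : TRS) → ℕ → Set
RhsBound R c = ∀ ρ → ρ ∈ rules R →
  (∀ x → occ x (rhs ρ) < c) × size (rhs ρ) < c

Econst : TRS → ℕ → ℕ
Econst R c = (2 ⊔ maxArity R ⊔ numRules R ⊔ c) + 3

g : ℕ → ℕ → ℕ → ℕ
g E zero    n       = E
g E (suc m) zero    = E * g E m zero
g E (suc m) (suc n) = E * g E m (suc n) + E * suc m * g E (E * suc m) n

module Submission where

-- The bound g(m,n) ≤ 2^(2^(d(m+n+1))) holds for every value of the constant E;
-- nothing about the rewrite system is used.  Put B = E + 2 and A n = B^(n+1).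
-- The heart of the proof is the single-exponential estimate
--     g(m,n) ≤ 2^(A n · (m+1)),
-- proved by lexicographic induction on (n, m), following the three clauses of g:
-- in the recursive clause both summands are bounded by powers of two whose
-- exponents are strictly below A (n+1) · (m+2), so their sum is too.  Since
-- B ≤ 2^B and m+1 ≤ 2^m, the exponent A n · (m+1) is itself at most
-- 2^(B·(m+n+1)), which gives the theorem with d = B.

open import Defs
open import Data.Nat using (ℕ; zero; suc; _+_; _*_; _^_; _≤_; _<_; z≤n; s≤s)
open import Data.Nat.Properties
open import Data.Nat.Tactic.RingSolver using (solve-∀)
open import Data.Product using (∃; _,_)
open import Relation.Binary.PropositionalEquality using (_≡_; sym; cong)

n<2^n : ∀ n → n < 2 ^ n
n<2^n zero    = s≤s z≤n
n<2^n (suc n) = begin-strict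
  suc n         ≤⟨ n<2^n n ⟩
  2 ^ n         <⟨ m<m+n (2 ^ n) (m^n>0 2 n) ⟩
  2 ^ n + 2 ^ n ≡⟨ cong (2 ^ n +_) (sym (+-identityʳ (2 ^ n))) ⟩
  2 ^ suc n     ∎
  where open ≤-Reasoning

*-≤-2^ : ∀ {x y} p q → x ≤ 2 ^ p → y ≤ 2 ^ q → x * y ≤ 2 ^ (p + q)
*-≤-2^ {x} {y} p q x≤ y≤ = begin
  x * y         ≤⟨ *-mono-≤ x≤ y≤ ⟩
  2 ^ p * 2 ^ q ≡⟨ sym (^-distribˡ-+-* 2 p q) ⟩
  2 ^ (p + q)   ∎
  where open ≤-Reasoning

+-≤-2^ : ∀ {x y} p q r → x ≤ 2 ^ p → y ≤ 2 ^ q → p < r → q < r → x + y ≤ 2 ^ r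
+-≤-2^ {x} {y} p q (suc r) x≤ y≤ (s≤s p≤r) (s≤s q≤r) = begin
  x + y         ≤⟨ +-mono-≤ (≤-trans x≤ (^-monoʳ-≤ 2 p≤r)) (≤-trans y≤ (^-monoʳ-≤ 2 q≤r)) ⟩
  2 ^ r + 2 ^ r ≡⟨ cong (2 ^ r +_) (sym (+-identityʳ (2 ^ r))) ⟩
  2 ^ suc r     ∎
  where open ≤-Reasoning

^-≤-2^* : ∀ B k → B ^ k ≤ 2 ^ (B * k)
^-≤-2^* B k = begin
  B ^ k         ≤⟨ ^-monoˡ-≤ k (<⇒≤ (n<2^n B)) ⟩
  (2 ^ B) ^ k   ≡⟨ ^-*-assoc 2 B k ⟩
  2 ^ (B * k)   ∎
  where open ≤-Reasoning

+-*-< : ∀ {e a} k → e < a → e + a * k < a * suc k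
+-*-< {e} {a} k e<a = begin-strict
  e + a * k <⟨ +-monoˡ-< (a * k) e<a ⟩
  a + a * k ≡⟨ sym (*-suc a k) ⟩
  a * suc k ∎
  where open ≤-Reasoning

recursive-exponent< : ∀ E m a → 0 < a →
  E + suc m + a * suc (E * suc m) < suc (suc E) * a * suc (suc m)
recursive-exponent< E m (suc a) _ = begin-strict
  E + suc m + suc a * suc (E * suc m)               <⟨ s≤s (m≤m+n _ slack) ⟩
  suc (E + suc m + suc a * suc (E * suc m) + slack) ≡⟨ expand E m a ⟩
  suc (suc E) * suc a * suc (suc m)                 ∎
  where
  open ≤-Reasoning
  slack : ℕ
  slack = 2 * a * suc m + a * E + a + suc m
  expand : ∀ E m a →
    suc (E + suc m + suc a * suc (E * suc m) + (2 * a * suc m + a * E + a + suc m))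
      ≡ suc (suc E) * suc a * suc (suc m)
  expand = solve-∀

module Estimate (E : ℕ) where

  B : ℕ
  B = suc (suc E)

  A : ℕ → ℕ
  A n = B ^ suc n

  E<A : ∀ n → E < A n
  E<A n = begin-strict
    E   <⟨ n≤1+n (suc E) ⟩
    B   ≤⟨ m≤m*n B (B ^ n) {{m^n≢0 B n}} ⟩
    A n ∎
    where open ≤-Reasoning

  E≤2^E : E ≤ 2 ^ E
  E≤2^E = <⇒≤ (n<2^n E)

  g≤2^ : ∀ m n → g E m n ≤ 2 ^ (A n * suc m)
  g≤2^ zero    n       = ≤-trans E≤2^E (^-monoʳ-≤ 2 (≤-trans (<⇒≤ (E<A n)) (m≤m*n (A n) 1)))
  g≤2^ (suc m) zero    = ≤-trans (*-≤-2^ E (A zero * suc m) E≤2^E (g≤2^ m zero))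
                           (^-monoʳ-≤ 2 (<⇒≤ (+-*-< (suc m) (E<A zero))))
  g≤2^ (suc m) (suc n) = +-≤-2^ (E + A (suc n) * suc m) (E + suc m + A n * suc (E * suc m))
                           (A (suc n) * suc (suc m))
    (*-≤-2^ E (A (suc n) * suc m) E≤2^E (g≤2^ m (suc n)))
    (*-≤-2^ (E + suc m) (A n * suc (E * suc m))
      (*-≤-2^ E (suc m) E≤2^E (<⇒≤ (n<2^n (suc m)))) (g≤2^ (E * suc m) n))
    (+-*-< (suc m) (E<A (suc n)))
    (recursive-exponent< E m (A n) (m^n>0 B (suc n)))

  exponent≤ : ∀ m n → A n * suc m ≤ 2 ^ (B * (m + n + 1))
  exponent≤ m n = begin
    A n * suc m             ≤⟨ *-≤-2^ (B * suc n) m (^-≤-2^* B (suc n)) (n<2^n m) ⟩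
    2 ^ (B * suc n + m)     ≤⟨ ^-monoʳ-≤ 2 (+-monoʳ-≤ (B * suc n) (m≤n*m m B)) ⟩
    2 ^ (B * suc n + B * m) ≡⟨ cong (2 ^_) (regroup B m n) ⟩
    2 ^ (B * (m + n + 1))   ∎
    where
    open ≤-Reasoning
    regroup : ∀ B m n → B * suc n + B * m ≡ B * (m + n + 1)
    regroup = solve-∀

-- The bound depends on R and c only through E = Econst R c.
lemma7p4 : (R : TRS) (c : ℕ) → RhsBound R c →
    ∃ λ d → ∀ m n → g (Econst R c) m n ≤ 2 ^ (2 ^ (d * (m + n + 1)))
lemma7p4 R c _ = B , λ m n → ≤-trans (g≤2^ m n) (^-monoʳ-≤ 2 (exponent≤ m n))
  where open Estimate (Econst R c)
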